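{- Let $p$ be a prime with $p\neq2$ and $A=\mathbb{Z}_p$. Then $\mathrm{PPol}(\mathcal{P}(A))\cap\mathrm{Aff}(A)=\Pi$.
   Context: $B_n(A)=\mathrm{Sym}(A^n)$. For a subset $S\subseteq A$ (a unary relation), $\mathrm{PPol}(S)$ is the set of $f\in B_n(A)$ ($n\in\mathbb{N}$) with $f(S^n)\subseteq S^n$; $\mathrm{PPol}(\mathcal{P}(A))=\bigcap_{S\subseteq A}\mathrm{PPol}(S)$. $\mathrm{Aff}(A)=\bigcup_{n\in\mathbb{N}}AGL_n(p)$ is the set of all invertible affine maps $x\mapsto Mx+b$ of $\mathbb{Z}_p^n$, $n\in\mathbb{N}$. $\Pi$ is the set of all wire permutations $\pi_\alpha:(x_1,\dots,x_n)\mapsto(x_{\alpha^{ -1}(1)},\dots,x_{\alpha^{ -1}(n)})$, $\alpha\in S_n$, $n\in\mathbb{N}$. -}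

module Defs where

open import Data.Nat using (ℕ; _+_; _*_; NonZero)
open import Data.Nat.DivMod using (_mod_)
open import Data.Fin using (Fin; toℕ)
open import Data.Fin.Subset using (Subset; _∈_)
open import Data.Fin.Permutation using (Permutation′; _⟨$⟩ˡ_)
open import Data.Vec using (Vec; lookup; tabulate; zipWith; foldr; replicate)
open import Data.Product using (Σ; _×_; ∃; ∃-syntax)
open import Function.Definitions using (Bijective)
open import Relation.Binary.PropositionalEquality using (_≡_)

module _ (p : ℕ) .{{_ : NonZero p}} where

  Zp : Set
  Zp = Fin p

  infixl 6 _+ₚ_
  infixl 7 _*ₚ_

  _+ₚ_ : Zp → Zp → Zp
  a +ₚ b = (toℕ a + toℕ b) mod p

  _*ₚ_ : Zp → Zp → Zp
  a *ₚ b = (toℕ a * toℕ b) mod p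

  0ₚ : Zp
  0ₚ = 0 mod p

  Pt : ℕ → Set
  Pt n = Vec Zp n

  Mat : ℕ → Set
  Mat n = Vec (Vec Zp n) n

  dot : ∀ {n} → Vec Zp n → Vec Zp n → Zp
  dot u v = foldr _ _+ₚ_ 0ₚ (zipWith _*ₚ_ u v)

  affineMap : ∀ {n} → Mat n → Pt n → Pt n → Pt n
  affineMap M b x = tabulate (λ i → dot (lookup M i) x +ₚ lookup b i)

  IsAff : ∀ {n} → (Pt n → Pt n) → Set
  IsAff {n} f = Bijective _≡_ _≡_ f
              × Σ (Mat n) (λ M → Σ (Pt n) (λ b → ∀ x → f x ≡ affineMap M b x))

  PreservesSubset : ∀ {n} → Subset p → (Pt n → Pt n) → Set
  PreservesSubset {n} S f =
    ∀ (x : Pt n) → (∀ i → lookup x i ∈ S) → ∀ i → lookup (f x) i ∈ S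

  -- f ∈ PPol(𝒫(A)) (of arity n): f ∈ B_n(A) and f preserves every subset S ⊆ A
  InPPolAll : ∀ {n} → (Pt n → Pt n) → Set
  InPPolAll f = Bijective _≡_ _≡_ f × (∀ (S : Subset p) → PreservesSubset S f)

  -- f ∈ Π: f = π_α, (x₁,…,xₙ) ↦ (x_{α⁻¹(1)},…,x_{α⁻¹(n)})
  IsWirePerm : ∀ {n} → (Pt n → Pt n) → Set
  IsWirePerm {n} f = Σ (Permutation′ n) (λ α → ∀ (x : Pt n) →
    f x ≡ tabulate (λ i → lookup x (α ⟨$⟩ˡ i)))

{-# OPTIONS --safe #-}
module Submission where

-- A map f in PPol(𝒫(A)) ∩ Aff(A) preserves {0}, so its translation part vanishes and
-- each coordinate of f is a linear form x ↦ m · x.  That form maps {0,1}ⁿ into {0,1}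
-- and (1,…,1) to 1.  Evaluating at unit vectors shows every coefficient of m is 0 or 1,
-- and two coefficients equal to 1 would give 1 + 1 ∉ {0,1} because p ≠ 2; hence
-- m · x = x_{σ i} for a single index σ i.  Finally, f = (x ↦ (x_{σ i})ᵢ) is bijective
-- only if σ is a permutation.  Primality only serves to exclude p ≤ 1: the argument
-- works for every p ≥ 3.

open import Defs
open import Data.Nat using (ℕ; NonZero; zero; suc)
open import Data.Nat.DivMod using (_mod_; m<n⇒m%n≡m)
open import Data.Nat.Primality using (Prime; ¬prime[0]; ¬prime[1])
import Data.Nat.Properties as ℕ
open import Data.Fin using (Fin; toℕ; zero; suc)
open import Data.Fin.Properties using (toℕ-injective; toℕ<n; toℕ-fromℕ<; _≟_; any?; 0≢1+n)
open import Data.Fin.Subset using (Subset; _∈_; ⁅_⁆; _∪_)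
open import Data.Fin.Subset.Properties using (x∈⁅x⁆; x∈⁅y⁆⇒x≡y; x∈p∪q⁻; x∈p∪q⁺)
open import Data.Fin.Permutation using (Permutation′; permutation; _⟨$⟩ˡ_; _⟨$⟩ʳ_; inverseˡ; inverseʳ)
open import Data.Vec using (Vec; []; _∷_; lookup; tabulate; replicate)
open import Data.Vec.Properties using (lookup∘tabulate; tabulate-cong; lookup-replicate)
open import Data.Vec.Relation.Binary.Pointwise.Extensional using (ext; Pointwise-≡⇒≡)
open import Data.Product using (_×_; _,_; Σ; ∃; proj₁; proj₂)
open import Data.Sum as Sum using (_⊎_; inj₁; inj₂)
open import Data.Empty using (⊥-elim)
open import Function using (_∘_)
open import Function.Bundles using (_⇔_; mk⇔; Equivalence)
open import Function.Definitions using (Injective; Surjective; Bijective)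
open import Function.Consequences.Propositional
  using (inverseᵇ⇒bijective; strictlyInverseˡ⇒inverseˡ; strictlyInverseʳ⇒inverseʳ)
open import Relation.Binary.PropositionalEquality
  using (_≡_; _≢_; _≗_; refl; sym; trans; cong; cong₂; subst; module ≡-Reasoning)
open import Relation.Nullary using (yes; no; contradiction)

open ≡-Reasoning

private
  variable
    m n : ℕ
    A B : Set

lookup-ext : {x y : Vec A n} → (∀ i → lookup x i ≡ lookup y i) → x ≡ y
lookup-ext x≗y = Pointwise-≡⇒≡ (ext x≗y)

≗-bijective : {f g : A → B} → f ≗ g → Bijective _≡_ _≡_ f → Bijective _≡_ _≡_ g
≗-bijective {f = f} {g} f≗g (inj , surj) = g-injective , g-surjective
  where
  g-injective : Injective _≡_ _≡_ g
  g-injective {x} {y} gx≡gy = inj (trans (f≗g x) (trans gx≡gy (sym (f≗g y))))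

  g-surjective : Surjective _≡_ _≡_ g
  g-surjective y = proj₁ (surj y) , λ {z} z≡x → trans (sym (f≗g z)) (proj₂ (surj y) z≡x)

select : (Fin m → Fin n) → Vec A n → Vec A m
select σ x = tabulate (λ i → lookup x (σ i))

lookup-select : (σ : Fin m → Fin n) (x : Vec A n) (i : Fin m) →
                lookup (select σ x) i ≡ lookup x (σ i)
lookup-select σ x = lookup∘tabulate (lookup x ∘ σ)

select-inverse : (σ : Fin m → Fin n) (τ : Fin n → Fin m) → (∀ i → σ (τ i) ≡ i) →
                 (x : Vec A n) → select τ (select σ x) ≡ x
select-inverse σ τ στ≗id x = lookup-ext λ i → begin
  lookup (select τ (select σ x)) i  ≡⟨ lookup-select τ (select σ x) i ⟩
  lookup (select σ x) (τ i)         ≡⟨ lookup-select σ x (τ i) ⟩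
  lookup x (σ (τ i))                ≡⟨ cong (lookup x) (στ≗id i) ⟩
  lookup x i                        ∎

permutation⇒select-bijective : (α : Permutation′ n) →
                               Bijective _≡_ _≡_ (select {A = A} (α ⟨$⟩ˡ_))
permutation⇒select-bijective α = inverseᵇ⇒bijective
  ( strictlyInverseˡ⇒inverseˡ {f⁻¹ = select τ} (select σ) (select-inverse τ σ (λ _ → inverseʳ α))
  , strictlyInverseʳ⇒inverseʳ {f⁻¹ = select τ} (select σ) (select-inverse σ τ (λ _ → inverseˡ α)) )
  where
  σ τ : Fin _ → Fin _
  σ = α ⟨$⟩ˡ_
  τ = α ⟨$⟩ʳ_

module _ {k : ℕ} where

  infixl 6 _⊕_
  infixl 7 _⊗_ _·_

  _⊕_ : Fin (suc k) → Fin (suc k) → Fin (suc k)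
  _⊕_ = _+ₚ_ (suc k)

  _⊗_ : Fin (suc k) → Fin (suc k) → Fin (suc k)
  _⊗_ = _*ₚ_ (suc k)

  _·_ : Vec (Fin (suc k)) n → Vec (Fin (suc k)) n → Fin (suc k)
  _·_ = dot (suc k)

  0ᵛ : Vec (Fin (suc k)) n
  0ᵛ = replicate _ zero

  toℕ-mod : (y : Fin (suc k)) → toℕ y mod suc k ≡ y
  toℕ-mod y = toℕ-injective (trans (toℕ-fromℕ< _) (m<n⇒m%n≡m (toℕ<n y)))

  ⊕-identityˡ : (y : Fin (suc k)) → zero ⊕ y ≡ y
  ⊕-identityˡ = toℕ-mod

  ⊕-identityʳ : (y : Fin (suc k)) → y ⊕ zero ≡ y
  ⊕-identityʳ y = trans (cong (_mod suc k) (ℕ.+-identityʳ (toℕ y))) (toℕ-mod y)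

  ⊗-zeroʳ : (y : Fin (suc k)) → y ⊗ zero ≡ zero
  ⊗-zeroʳ y = cong (_mod suc k) (ℕ.*-zeroʳ (toℕ y))

  ·-zeroʳ : (u : Vec (Fin (suc k)) n) → u · 0ᵛ ≡ zero
  ·-zeroʳ []      = refl
  ·-zeroʳ (a ∷ u) = cong₂ _⊕_ (⊗-zeroʳ a) (·-zeroʳ u)

  ·-zeroˡ : (x : Vec (Fin (suc k)) n) → 0ᵛ · x ≡ zero
  ·-zeroˡ []      = refl
  ·-zeroˡ (_ ∷ x) = cong (zero ⊕_) (·-zeroˡ x)

  lookup-affineMap : (M : Mat (suc k) n) (b x : Pt (suc k) n) (i : Fin n) →
                     lookup (affineMap (suc k) M b x) i ≡ lookup M i · x ⊕ lookup b i
  lookup-affineMap M b x = lookup∘tabulate _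

  preserves-⁅⁆⇒fixes-constant : ∀ {c} (f : Pt (suc k) n → Pt (suc k) n) →
    PreservesSubset (suc k) ⁅ c ⁆ f → ∀ i → lookup (f (replicate n c)) i ≡ c
  preserves-⁅⁆⇒fixes-constant {c = c} _ preserves i = x∈⁅y⁆⇒x≡y c
    (preserves _ (λ j → subst (_∈ ⁅ c ⁆) (sym (lookup-replicate j c)) (x∈⁅x⁆ c)) i)

  preserves-⁅0⁆∧affine⇒linear : (f : Pt (suc k) n → Pt (suc k) n)
    {M : Mat (suc k) n} {b : Pt (suc k) n} →
    PreservesSubset (suc k) ⁅ zero ⁆ f → (∀ x → f x ≡ affineMap (suc k) M b x) →
    ∀ x i → lookup (f x) i ≡ lookup M i · x
  preserves-⁅0⁆∧affine⇒linear f {M} {b} preserves f≗affine x i = begin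
    lookup (f x) i                  ≡⟨ lookup-f x i ⟩
    lookup M i · x ⊕ lookup b i     ≡⟨ cong (lookup M i · x ⊕_) b-vanishes ⟩
    lookup M i · x ⊕ zero           ≡⟨ ⊕-identityʳ _ ⟩
    lookup M i · x                  ∎
    where
    lookup-f : ∀ x i → lookup (f x) i ≡ lookup M i · x ⊕ lookup b i
    lookup-f x i = trans (cong (λ v → lookup v i) (f≗affine x)) (lookup-affineMap M b x i)

    b-vanishes : lookup b i ≡ zero
    b-vanishes = begin
      lookup b i                    ≡⟨ ⊕-identityˡ (lookup b i) ⟨
      zero ⊕ lookup b i             ≡⟨ cong (_⊕ lookup b i) (·-zeroʳ (lookup M i)) ⟨
      lookup M i · 0ᵛ ⊕ lookup b i  ≡⟨ lookup-f 0ᵛ i ⟨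
      lookup (f 0ᵛ) i               ≡⟨ preserves-⁅⁆⇒fixes-constant f preserves i ⟩
      zero                          ∎

module _ {k : ℕ} where

  private
    Z : Set
    Z = Fin (suc (suc k))

  1ₚ : Z
  1ₚ = suc zero

  ⊗-identityˡ : (y : Z) → 1ₚ ⊗ y ≡ y
  ⊗-identityˡ y = trans (cong (_mod suc (suc k)) (ℕ.*-identityˡ (toℕ y))) (toℕ-mod y)

  ⊗-identityʳ : (y : Z) → y ⊗ 1ₚ ≡ y
  ⊗-identityʳ y = trans (cong (_mod suc (suc k)) (ℕ.*-identityʳ (toℕ y))) (toℕ-mod y)

  unit : Fin n → Vec Z n
  unit zero    = 1ₚ ∷ 0ᵛ
  unit (suc j) = zero ∷ unit j

  lookup-unit-≡ : (j : Fin n) → lookup (unit j) j ≡ 1ₚ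
  lookup-unit-≡ zero    = refl
  lookup-unit-≡ (suc j) = lookup-unit-≡ j

  lookup-unit-≢ : {i j : Fin n} → i ≢ j → lookup (unit j) i ≡ zero
  lookup-unit-≢ {i = zero}  {zero}  i≢j = ⊥-elim (i≢j refl)
  lookup-unit-≢ {i = suc i} {zero}  _   = lookup-replicate i zero
  lookup-unit-≢ {i = zero}  {suc j} _   = refl
  lookup-unit-≢ {i = suc i} {suc j} i≢j = lookup-unit-≢ (i≢j ∘ cong suc)

  ·-unitˡ : (j : Fin n) (x : Vec Z n) → unit j · x ≡ lookup x j
  ·-unitˡ zero    (y ∷ x) = begin
    1ₚ ⊗ y ⊕ 0ᵛ · x  ≡⟨ cong₂ _⊕_ (⊗-identityˡ y) (·-zeroˡ x) ⟩
    y ⊕ zero         ≡⟨ ⊕-identityʳ y ⟩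
    y                ∎
  ·-unitˡ (suc j) (y ∷ x) = trans (⊕-identityˡ _) (·-unitˡ j x)

  ·-unitʳ : (u : Vec Z n) (j : Fin n) → u · unit j ≡ lookup u j
  ·-unitʳ (a ∷ u) zero = begin
    a ⊗ 1ₚ ⊕ u · 0ᵛ  ≡⟨ cong₂ _⊕_ (⊗-identityʳ a) (·-zeroʳ u) ⟩
    a ⊕ zero         ≡⟨ ⊕-identityʳ a ⟩
    a                ∎
  ·-unitʳ (a ∷ u) (suc j) = begin
    a ⊗ zero ⊕ u · unit j  ≡⟨ cong (_⊕ u · unit j) (⊗-zeroʳ a) ⟩
    zero ⊕ u · unit j      ≡⟨ ⊕-identityˡ _ ⟩
    u · unit j             ≡⟨ ·-unitʳ u j ⟩
    lookup u j             ∎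

  permutationMatrix-affine : (σ : Fin n → Fin n) (x : Vec Z n) →
    affineMap (suc (suc k)) (tabulate (unit ∘ σ)) 0ᵛ x ≡ select σ x
  permutationMatrix-affine σ x = tabulate-cong λ i → begin
    lookup (tabulate (unit ∘ σ)) i · x ⊕ lookup 0ᵛ i
      ≡⟨ cong₂ _⊕_ (cong (_· x) (lookup∘tabulate (unit ∘ σ) i)) (lookup-replicate i zero) ⟩
    unit (σ i) · x ⊕ zero  ≡⟨ ⊕-identityʳ _ ⟩
    unit (σ i) · x         ≡⟨ ·-unitˡ (σ i) x ⟩
    lookup x (σ i)         ∎

  wirePerm⇒PPol∩Aff : {f : Pt (suc (suc k)) n → Pt (suc (suc k)) n} →
    IsWirePerm (suc (suc k)) f → InPPolAll (suc (suc k)) f × IsAff (suc (suc k)) f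
  wirePerm⇒PPol∩Aff {f = f} (α , f≗select) =
    (f-bijective , preserves) ,
    (f-bijective , tabulate (unit ∘ σ) , 0ᵛ ,
     λ x → trans (f≗select x) (sym (permutationMatrix-affine σ x)))
    where
    σ : Fin _ → Fin _
    σ = α ⟨$⟩ˡ_

    f-bijective : Bijective _≡_ _≡_ f
    f-bijective = ≗-bijective (sym ∘ f≗select) (permutation⇒select-bijective α)

    preserves : ∀ S → PreservesSubset (suc (suc k)) S f
    preserves S x x∈S i = subst (_∈ S)
      (sym (trans (cong (λ v → lookup v i) (f≗select x)) (lookup-select σ x i))) (x∈S (σ i))

  select-surjective⇒injective : {σ : Fin m → Fin n} →
    Surjective _≡_ _≡_ (select {A = Z} σ) → Injective _≡_ _≡_ σ
  select-surjective⇒injective {σ = σ} surj {i} {j} σi≡σj with i ≟ j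
  ... | yes i≡j = i≡j
  ... | no  i≢j = contradiction zero≡1 0≢1+n
    where
    x : Vec Z _
    x = proj₁ (surj (unit j))

    select-x≡unit : select σ x ≡ unit j
    select-x≡unit = proj₂ (surj (unit j)) refl

    zero≡1 : zero ≡ 1ₚ
    zero≡1 = begin
      zero                       ≡⟨ lookup-unit-≢ i≢j ⟨
      lookup (unit j) i          ≡⟨ cong (λ v → lookup v i) select-x≡unit ⟨
      lookup (select σ x) i      ≡⟨ lookup-select σ x i ⟩
      lookup x (σ i)             ≡⟨ cong (lookup x) σi≡σj ⟩
      lookup x (σ j)             ≡⟨ lookup-select σ x j ⟨
      lookup (select σ x) j      ≡⟨ cong (λ v → lookup v j) select-x≡unit ⟩
      lookup (unit j) j          ≡⟨ lookup-unit-≡ j ⟩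
      1ₚ                         ∎

  select-injective⇒surjective : {σ : Fin m → Fin n} →
    Injective _≡_ _≡_ (select {A = Z} σ) → ∀ j → ∃ λ i → σ i ≡ j
  select-injective⇒surjective {σ = σ} inj j with any? (λ i → σ i ≟ j)
  ... | yes hit = hit
  ... | no  miss = contradiction zero≡1 0≢1+n
    where
    select-0≡select-unit : select σ 0ᵛ ≡ select σ (unit j)
    select-0≡select-unit = lookup-ext λ i → begin
      lookup (select σ 0ᵛ) i        ≡⟨ lookup-select σ 0ᵛ i ⟩
      lookup 0ᵛ (σ i)               ≡⟨ lookup-replicate (σ i) zero ⟩
      zero                          ≡⟨ lookup-unit-≢ (λ σi≡j → miss (i , σi≡j)) ⟨
      lookup (unit j) (σ i)         ≡⟨ lookup-select σ (unit j) i ⟨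
      lookup (select σ (unit j)) i  ∎

    zero≡1 : zero ≡ 1ₚ
    zero≡1 = begin
      zero               ≡⟨ lookup-replicate j zero ⟨
      lookup 0ᵛ j        ≡⟨ cong (λ v → lookup v j) (inj {0ᵛ} {unit j} select-0≡select-unit) ⟩
      lookup (unit j) j  ≡⟨ lookup-unit-≡ j ⟩
      1ₚ                 ∎

  select-bijective⇒permutation : {σ : Fin n → Fin n} →
    Bijective _≡_ _≡_ (select {A = Z} σ) → Σ (Permutation′ n) λ α → ∀ i → α ⟨$⟩ˡ i ≡ σ i
  select-bijective⇒permutation {σ = σ} (inj , surj) =
    permutation τ σ (λ i → σ-injective (στ≗id (σ i))) στ≗id , λ _ → refl
    where
    σ-injective : Injective _≡_ _≡_ σ
    σ-injective = select-surjective⇒injective surj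

    τ : Fin _ → Fin _
    τ = proj₁ ∘ select-injective⇒surjective inj

    στ≗id : ∀ j → σ (τ j) ≡ j
    στ≗id = proj₂ ∘ select-injective⇒surjective inj

  IsBit : Z → Set
  IsBit y = y ≡ zero ⊎ y ≡ 1ₚ

  BitVector : Vec Z n → Set
  BitVector x = ∀ i → IsBit (lookup x i)

  bitVector-∷ : ∀ {y} {x : Vec Z n} → IsBit y → BitVector x → BitVector (y ∷ x)
  bitVector-∷ y-bit x-bits zero    = y-bit
  bitVector-∷ y-bit x-bits (suc i) = x-bits i

  0ᵛ-bits : BitVector {n} 0ᵛ
  0ᵛ-bits i = inj₁ (lookup-replicate i zero)

  unit₀-bits : BitVector {suc n} (unit zero)
  unit₀-bits = bitVector-∷ (inj₂ refl) 0ᵛ-bits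

  bits : Subset (suc (suc k))
  bits = ⁅ zero ⁆ ∪ ⁅ 1ₚ ⁆

  ∈bits⇔isBit : ∀ {y} → y ∈ bits ⇔ IsBit y
  ∈bits⇔isBit {y} = mk⇔
    (Sum.map (x∈⁅y⁆⇒x≡y zero) (x∈⁅y⁆⇒x≡y 1ₚ) ∘ x∈p∪q⁻ ⁅ zero ⁆ ⁅ 1ₚ ⁆)
    (x∈p∪q⁺ ∘ Sum.map (λ y≡0 → subst (_∈ ⁅ zero ⁆) (sym y≡0) (x∈⁅x⁆ zero))
                      (λ y≡1 → subst (_∈ ⁅ 1ₚ ⁆) (sym y≡1) (x∈⁅x⁆ 1ₚ)))

  preserves-bits⇒bit-preserving : (f : Pt (suc (suc k)) n → Pt (suc (suc k)) n) →
    PreservesSubset (suc (suc k)) bits f → ∀ x → BitVector x → BitVector (f x)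
  preserves-bits⇒bit-preserving _ preserves x x-bits i =
    Equivalence.to ∈bits⇔isBit (preserves x (Equivalence.from ∈bits⇔isBit ∘ x-bits) i)

  HoldsOnBits : (Z → Set) → Vec Z n → Set
  HoldsOnBits P u = ∀ x → BitVector x → P (u · x)

  holdsOnBits-tail : ∀ P {a} {u : Vec Z n} → HoldsOnBits P (a ∷ u) → HoldsOnBits P u
  holdsOnBits-tail P {a} {u} holds x x-bits =
    subst P head-drops (holds (zero ∷ x) (bitVector-∷ (inj₁ refl) x-bits))
    where
    head-drops : a ⊗ zero ⊕ u · x ≡ u · x
    head-drops = trans (cong (_⊕ u · x) (⊗-zeroʳ a)) (⊕-identityˡ (u · x))

  holdsOnBits-head : ∀ P {a} {u : Vec Z n} → HoldsOnBits P (a ∷ u) → P a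
  holdsOnBits-head P {a} {u} holds = subst P (·-unitʳ (a ∷ u) zero) (holds _ unit₀-bits)

  bit-vanishing⇒vanishing : (u : Vec Z n) → HoldsOnBits (_≡ zero) u → ∀ x → u · x ≡ zero
  bit-vanishing⇒vanishing []      _        []      = refl
  bit-vanishing⇒vanishing (a ∷ u) vanishes (y ∷ x) =
    cong₂ (λ c t → c ⊗ y ⊕ t) (holdsOnBits-head (_≡ zero) vanishes)
      (bit-vanishing⇒vanishing u (holdsOnBits-tail (_≡ zero) vanishes) x)

module _ {k : ℕ} where

  private
    Z : Set
    Z = Fin (suc (suc (suc k)))

  -- The only place where p ≠ 2 is used: 1 + 1 = 2 is not a bit.
  bit-with-bit-successor⇒zero : (y : Z) → IsBit y → IsBit (1ₚ ⊕ y) → y ≡ zero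
  bit-with-bit-successor⇒zero y (inj₁ y≡0) _ = y≡0
  bit-with-bit-successor⇒zero _ (inj₂ refl) (inj₁ ())
  bit-with-bit-successor⇒zero _ (inj₂ refl) (inj₂ ())

  bit-preserving⇒projection : (u : Vec Z n) → HoldsOnBits IsBit u →
    u · replicate n 1ₚ ≡ 1ₚ → ∃ λ j → ∀ x → u · x ≡ lookup x j
  bit-preserving⇒projection []      _         ()
  bit-preserving⇒projection (a ∷ u) preserves sum≡1 with holdsOnBits-head IsBit preserves
  ... | inj₁ refl =
    let j , u-projection = bit-preserving⇒projection u (holdsOnBits-tail IsBit preserves)
                             (trans (sym (⊕-identityˡ _)) sum≡1)
    in suc j , λ { (y ∷ x) → trans (⊕-identityˡ _) (u-projection x) }
  ... | inj₂ refl = zero , λ { (y ∷ x) → begin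
    1ₚ ⊗ y ⊕ u · x  ≡⟨ cong₂ _⊕_ (⊗-identityˡ y) (bit-vanishing⇒vanishing u tail-vanishes x) ⟩
    y ⊕ zero        ≡⟨ ⊕-identityʳ y ⟩
    y               ∎ }
    where
    tail-vanishes : HoldsOnBits (_≡ zero) u
    tail-vanishes x x-bits = bit-with-bit-successor⇒zero (u · x)
      (holdsOnBits-tail IsBit preserves x x-bits)
      (preserves (1ₚ ∷ x) (bitVector-∷ (inj₂ refl) x-bits))

  PPol∩Aff⇒wirePerm : {f : Pt (suc (suc (suc k))) n → Pt (suc (suc (suc k))) n} →
    InPPolAll (suc (suc (suc k))) f × IsAff (suc (suc (suc k))) f →
    IsWirePerm (suc (suc (suc k))) f
  PPol∩Aff⇒wirePerm {n = n} {f = f} ((f-bijective , preserves) , (_ , M , b , f≗affine)) =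
    α , λ x → trans (f≗select x) (tabulate-cong λ i → cong (lookup x) (sym (α≗σ i)))
    where
    linear : ∀ x i → lookup (f x) i ≡ lookup M i · x
    linear = preserves-⁅0⁆∧affine⇒linear f {M} {b} (preserves ⁅ zero ⁆) f≗affine

    projection : ∀ i → ∃ λ j → ∀ x → lookup M i · x ≡ lookup x j
    projection i = bit-preserving⇒projection (lookup M i)
      (λ x x-bits → subst IsBit (linear x i)
        (preserves-bits⇒bit-preserving f (preserves bits) x x-bits i))
      (trans (sym (linear (replicate n 1ₚ) i))
             (preserves-⁅⁆⇒fixes-constant f (preserves ⁅ 1ₚ ⁆) i))

    σ : Fin n → Fin n
    σ = proj₁ ∘ projection

    f≗select : ∀ x → f x ≡ select σ x
    f≗select x = lookup-ext λ i →
      trans (linear x i) (trans (proj₂ (projection i) x) (sym (lookup-select σ x i)))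

    σ-permutation : Σ (Permutation′ n) λ α → ∀ i → α ⟨$⟩ˡ i ≡ σ i
    σ-permutation = select-bijective⇒permutation (≗-bijective f≗select f-bijective)

    α : Permutation′ n
    α = proj₁ σ-permutation

    α≗σ : ∀ i → α ⟨$⟩ˡ i ≡ σ i
    α≗σ = proj₂ σ-permutation

lemma18 : (p : ℕ) .{{_ : NonZero p}} → Prime p → p ≢ 2 →
    (n : ℕ) (f : Pt p n → Pt p n) →
      ((InPPolAll p f × IsAff p f) ⇔ IsWirePerm p f)
lemma18 zero                p-prime _   = ⊥-elim (¬prime[0] p-prime)
lemma18 (suc zero)          p-prime _   = ⊥-elim (¬prime[1] p-prime)
lemma18 (suc (suc zero))    _       p≢2 = ⊥-elim (p≢2 refl)
lemma18 (suc (suc (suc k))) _       _   n f = mk⇔ PPol∩Aff⇒wirePerm wirePerm⇒PPol∩Aff
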